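{- Let $F,\bar F\subseteq\mathbb{N}$ be reciprocals, not both equal to $\{0\}$, and let $r$ be the least positive integer in $F\cup\bar F$. Then for every positive integer $n$, \[ |F\cap[0,n]|+|\bar F\cap[0,n]|\ge 2+\Big\lfloor\log_2\frac{n}{r}\Big\rfloor. \]
   Context: Sets $F,\bar F\subseteq\mathbb{N}=\{0,1,2,\dots\}$ are reciprocals if $\big(\sum_{a\in F}q^a\big)\big(\sum_{b\in\bar F}q^b\big)=1$ in $\mathbb{F}_2[[q]]$ (in particular both contain $0$). -}

module Defs where

open import Data.Bool using (Bool; true; false; _∧_; _∨_; _xor_; if_then_else_)
open import Data.Nat using (ℕ; zero; suc; _+_; _*_; _∸_; _≤ᵇ_; _≡ᵇ_; _/_; _≤_; _<_)
open import Data.Nat.Logarithm using (⌊log₂_⌋; ⌈log₂_⌉)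
open import Data.Integer using (ℤ; +_; -_)
open import Relation.Binary.PropositionalEquality using (_≡_)
open import Data.Product using (_×_)

Subset : Set
Subset = ℕ → Bool

xorUpTo : (ℕ → Bool) → ℕ → Bool
xorUpTo f zero    = f zero
xorUpTo f (suc n) = xorUpTo f n xor f (suc n)

-- Coefficient of q^n in (Σ_{a∈F} q^a)(Σ_{b∈G} q^b) over 𝔽₂.
convCoeff : Subset → Subset → ℕ → Bool
convCoeff F G n = xorUpTo (λ a → F a ∧ G (n ∸ a)) n

-- F and G are reciprocals: the product of their generating series is 1 in 𝔽₂[[q]].
Reciprocal : Subset → Subset → Set
Reciprocal F G = ∀ n → convCoeff F G n ≡ (n ≡ᵇ 0)

IsZeroSet : Subset → Set
IsZeroSet F = ∀ n → F n ≡ (n ≡ᵇ 0)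

countUpTo : Subset → ℕ → ℕ
countUpTo F zero    = if F zero then 1 else 0
countUpTo F (suc n) = countUpTo F n + (if F (suc n) then 1 else 0)

IsLeastPositiveIn : ℕ → Subset → Subset → Set
IsLeastPositiveIn r F G =
  (0 < r) × ((F r ∨ G r) ≡ true) × (∀ m → 0 < m → m < r → (F m ∨ G m) ≡ false)

-- ⌊log₂ (n / r)⌋ ∈ ℤ for positive n, r (rational quotient n/r).
-- If r ≤ n:  ⌊log₂(n/r)⌋ = ⌊log₂ ⌊n/r⌋⌋.
-- If n < r:  ⌊log₂(n/r)⌋ = - ⌈log₂(r/n)⌉ = - ⌈log₂ ⌈r/n⌉⌉, with ⌈r/n⌉ = (r + n ∸ 1) / n.
floorLog2Ratio : (n r : ℕ) → ℤ
floorLog2Ratio zero    r       = + 0   -- unused (n is positive in the theorem)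
floorLog2Ratio (suc k) zero    = + 0   -- unused (r is positive in the theorem)
floorLog2Ratio (suc k) (suc j) with suc j ≤ᵇ suc k
... | true  = + ⌊log₂ (suc k / suc j) ⌋
... | false = - (+ ⌈log₂ ((suc j + k) / suc k) ⌉)

{-# OPTIONS --safe #-}
-- If r ≤ m, then F ∪ G meets (m, 2m]. Otherwise let a and b be the largest elements
-- of F and G in [0, 2m]; both are at most m, so q^a · q^b is the only term that
-- contributes to the coefficient of q^(a+b) in the product of the two series. That
-- coefficient is therefore 1, which forces a + b = 0, whereas r ∈ F ∪ G lies in (0, 2m].
-- So the number of elements of F and G up to m strictly increases from m to 2m whenever
-- m ≥ r. It equals 2 at 0 (both sets contain 0), hence it is at least 2 + k at r·2^k.
module Submission where

open import Defs
open import Data.Bool using (Bool; true; false; _∧_; _∨_; _xor_; if_then_else_; T)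
open import Data.Bool.Properties using (∧-zeroʳ; ∧-conicalˡ; ∧-conicalʳ; xor-identityʳ)
open import Data.Empty using (⊥-elim)
open import Data.Sum using (_⊎_; inj₁; inj₂)
open import Data.Unit using (tt)
open import Relation.Binary.Definitions using (tri<; tri≈; tri>)
open import Relation.Binary.PropositionalEquality
open import Relation.Nullary using (yes; no; contradiction)

-- ℕ's arithmetic is opened only in here: the statement below uses ℤ's _+_ and _≤_.
module JointCount where

  open import Data.Nat
    using ( ℕ; zero; suc; _+_; _*_; _^_; _∸_; _≤_; _<_; _<?_; _/_; ⌊_/2⌋; ⌈_/2⌉
          ; z≤n; s≤s; z<s; NonZero; >-nonZero⁻¹)
  open import Data.Nat.Properties
  open import Data.Nat.DivMod using (m/n*n≤m; m≥n⇒m/n>0)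
  open import Data.Nat.Induction using (<-wellFounded)
  open import Data.Nat.Logarithm using (⌊log₂_⌋)
  open import Data.Nat.Logarithm.Core using (⌊log2⌋)
  open import Induction.WellFounded using (Acc; acc)

  variable
    F G : Subset
    f : ℕ → Bool
    m n x : ℕ

  countUpTo-mono : m ≤ n → countUpTo F m ≤ countUpTo F n
  countUpTo-mono {n = zero} z≤n = ≤-refl
  countUpTo-mono {m} {n = suc n} m≤1+n with m≤n⇒m<n∨m≡n m≤1+n
  ... | inj₁ (s≤s m≤n) = ≤-trans (countUpTo-mono m≤n) (m≤m+n _ _)
  ... | inj₂ refl      = ≤-refl

  countUpTo-< : m < x → x ≤ n → F x ≡ true → countUpTo F m < countUpTo F n
  countUpTo-< {m} {x = suc x} {n} {F} (s≤s m≤x) x≤n Fx = begin-strict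
    countUpTo F m        ≤⟨ countUpTo-mono m≤x ⟩
    countUpTo F x        <⟨ m<m+n _ (subst (λ b → 0 < (if b then 1 else 0)) (sym Fx) z<s) ⟩
    countUpTo F (suc x)  ≤⟨ countUpTo-mono x≤n ⟩
    countUpTo F n        ∎
    where open ≤-Reasoning

  -- 0 when F ∩ [0, n] is empty.
  lastUpTo : Subset → ℕ → ℕ
  lastUpTo F zero    = zero
  lastUpTo F (suc n) = if F (suc n) then suc n else lastUpTo F n

  lastUpTo-≤ : ∀ F n → lastUpTo F n ≤ n
  lastUpTo-≤ F zero    = z≤n
  lastUpTo-≤ F (suc n) with F (suc n)
  ... | true  = ≤-refl
  ... | false = m≤n⇒m≤1+n (lastUpTo-≤ F n)

  lastUpTo-∈ : (F : Subset) (n : ℕ) → F 0 ≡ true → F (lastUpTo F n) ≡ true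
  lastUpTo-∈ F zero    F0 = F0
  lastUpTo-∈ F (suc n) F0 with F (suc n) in Fn
  ... | true  = Fn
  ... | false = lastUpTo-∈ F n F0

  lastUpTo-maximal : lastUpTo F n < x → x ≤ n → F x ≡ false
  lastUpTo-maximal {n = zero} last<x x≤0 = ⊥-elim (<⇒≱ last<x x≤0)
  lastUpTo-maximal {F} {suc n} last<x x≤1+n with F (suc n) in Fn
  ... | true  = ⊥-elim (<⇒≱ last<x x≤1+n)
  ... | false with m≤n⇒m<n∨m≡n x≤1+n
  ...   | inj₁ (s≤s x≤n) = lastUpTo-maximal last<x x≤n
  ...   | inj₂ refl      = Fn

  xorUpTo-false : (∀ i → i ≤ n → f i ≡ false) → xorUpTo f n ≡ false
  xorUpTo-false {n = zero}  all = all 0 z≤n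
  xorUpTo-false {n = suc n} all =
    cong₂ _xor_ (xorUpTo-false λ i i≤n → all i (m≤n⇒m≤1+n i≤n)) (all (suc n) ≤-refl)

  xorUpTo-single : ∀ {a} → a ≤ n → (∀ i → i ≤ n → i ≢ a → f i ≡ false) → xorUpTo f n ≡ f a
  xorUpTo-single {n = zero} z≤n _ = refl
  xorUpTo-single {n = suc n} {f} {a} a≤1+n others with m≤n⇒m<n∨m≡n a≤1+n
  ... | inj₁ (s≤s a≤n) = begin
    xorUpTo f n xor f (suc n)  ≡⟨ cong₂ _xor_ (xorUpTo-single a≤n others≤n)
                                              (others (suc n) ≤-refl 1+n≢a) ⟩
    f a xor false              ≡⟨ xor-identityʳ (f a) ⟩
    f a                        ∎
    where
    open ≡-Reasoning
    others≤n : ∀ i → i ≤ n → i ≢ a → f i ≡ false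
    others≤n i i≤n = others i (m≤n⇒m≤1+n i≤n)
    1+n≢a : suc n ≢ a
    1+n≢a refl = 1+n≰n a≤n
  ... | inj₂ refl =
    cong (_xor f (suc n)) (xorUpTo-false λ i i≤n → others i (m≤n⇒m≤1+n i≤n) (<⇒≢ (s≤s i≤n)))

  convCoeff-top : ∀ {a b} → F a ≡ true → G b ≡ true →
                  (∀ i → a < i → i ≤ a + b → F i ≡ false) →
                  (∀ j → b < j → j ≤ a + b → G j ≡ false) →
                  convCoeff F G (a + b) ≡ true
  convCoeff-top {F} {G} {a} {b} Fa Gb F-above G-above = begin
    convCoeff F G (a + b)  ≡⟨ xorUpTo-single (m≤m+n a b) others ⟩
    F a ∧ G (a + b ∸ a)    ≡⟨ cong (λ j → F a ∧ G j) (m+n∸m≡n a b) ⟩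
    F a ∧ G b              ≡⟨ cong₂ _∧_ Fa Gb ⟩
    true                   ∎
    where
    open ≡-Reasoning
    others : ∀ i → i ≤ a + b → i ≢ a → (F i ∧ G (a + b ∸ i)) ≡ false
    others i i≤a+b i≢a with <-cmp i a
    ... | tri< i<a _ _ = trans (cong (F i ∧_) (G-above (a + b ∸ i) b<a+b∸i (m∸n≤m (a + b) i)))
                               (∧-zeroʳ (F i))
      where
      b<a+b∸i : b < a + b ∸ i
      b<a+b∸i = subst (_< a + b ∸ i) (m+n∸m≡n a b) (∸-monoʳ-< i<a (m≤m+n a b))
    ... | tri≈ _ i≡a _ = ⊥-elim (i≢a i≡a)
    ... | tri> _ _ a<i = cong (_∧ G (a + b ∸ i)) (F-above i a<i i≤a+b)

  jointCount : Subset → Subset → ℕ → ℕ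
  jointCount F G n = countUpTo F n + countUpTo G n

  jointCount-mono : m ≤ n → jointCount F G m ≤ jointCount F G n
  jointCount-mono m≤n = +-mono-≤ (countUpTo-mono m≤n) (countUpTo-mono m≤n)

  r*2^[1+k]≡r*2^k+r*2^k : ∀ r k → r * 2 ^ suc k ≡ r * 2 ^ k + r * 2 ^ k
  r*2^[1+k]≡r*2^k+r*2^k r k = trans (*-distribˡ-+ r (2 ^ k) (2 ^ k + 0))
                                     (cong (λ y → r * 2 ^ k + r * y) (+-identityʳ (2 ^ k)))

  2*⌊n/2⌋≤n : ∀ n → 2 * ⌊ n /2⌋ ≤ n
  2*⌊n/2⌋≤n n = begin
    2 * ⌊ n /2⌋            ≡⟨ cong (⌊ n /2⌋ +_) (+-identityʳ ⌊ n /2⌋) ⟩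
    ⌊ n /2⌋ + ⌊ n /2⌋      ≤⟨ +-monoʳ-≤ ⌊ n /2⌋ (⌊n/2⌋≤⌈n/2⌉ n) ⟩
    ⌊ n /2⌋ + ⌈ n /2⌉       ≡⟨ ⌊n/2⌋+⌈n/2⌉≡n n ⟩
    n                      ∎
    where open ≤-Reasoning

  2^⌊log2⌋n≤n : ∀ n (wf : Acc _<_ n) → 0 < n → 2 ^ ⌊log2⌋ n wf ≤ n
  2^⌊log2⌋n≤n (suc zero)    _        _ = ≤-refl
  2^⌊log2⌋n≤n (suc (suc n)) (acc rs) _ = begin
    2 * 2 ^ ⌊log2⌋ (suc ⌊ n /2⌋) _  ≤⟨ *-monoʳ-≤ 2 (2^⌊log2⌋n≤n (suc ⌊ n /2⌋) _ z<s) ⟩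
    2 * suc ⌊ n /2⌋                  ≡⟨ *-suc 2 ⌊ n /2⌋ ⟩
    2 + 2 * ⌊ n /2⌋                  ≤⟨ +-monoʳ-≤ 2 (2*⌊n/2⌋≤n n) ⟩
    2 + n                            ∎
    where open ≤-Reasoning

  r*2^⌊log₂n/r⌋≤n : ∀ r .{{_ : NonZero r}} → r ≤ n → r * 2 ^ ⌊log₂ (n / r) ⌋ ≤ n
  r*2^⌊log₂n/r⌋≤n {n} r r≤n = begin
    r * 2 ^ ⌊log₂ (n / r) ⌋  ≤⟨ *-monoʳ-≤ r (2^⌊log2⌋n≤n (n / r) (<-wellFounded _) (m≥n⇒m/n>0 r≤n)) ⟩
    r * (n / r)              ≡⟨ *-comm r (n / r) ⟩
    n / r * r                ≤⟨ m/n*n≤m n r ⟩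
    n                        ∎
    where open ≤-Reasoning

  module _ {F G : Subset} (rec : Reciprocal F G) where

    reciprocal-0ˡ : F 0 ≡ true
    reciprocal-0ˡ = ∧-conicalˡ (F 0) (G 0) (rec 0)

    reciprocal-0ʳ : G 0 ≡ true
    reciprocal-0ʳ = ∧-conicalʳ (F 0) (G 0) (rec 0)

    reciprocal-lastUpTo : lastUpTo F n + lastUpTo G n ≤ n → lastUpTo F n + lastUpTo G n ≡ 0
    reciprocal-lastUpTo {n} a+b≤n = ≡ᵇ⇒≡ (a + b) 0 (subst T (trans (sym top) (rec (a + b))) tt)
      where
      a = lastUpTo F n
      b = lastUpTo G n
      top : convCoeff F G (a + b) ≡ true
      top = convCoeff-top (lastUpTo-∈ F n reciprocal-0ˡ) (lastUpTo-∈ G n reciprocal-0ʳ)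
              (λ i a<i i≤a+b → lastUpTo-maximal a<i (≤-trans i≤a+b a+b≤n))
              (λ j b<j j≤a+b → lastUpTo-maximal b<j (≤-trans j≤a+b a+b≤n))

    jointCount-≥2 : 2 ≤ jointCount F G n
    jointCount-≥2 {n} =
      ≤-trans (≤-reflexive (sym jointCount-0)) (jointCount-mono {n = n} {F} {G} z≤n)
      where
      jointCount-0 : jointCount F G 0 ≡ 2
      jointCount-0 = cong₂ (λ p q → (if p then 1 else 0) + (if q then 1 else 0))
                           reciprocal-0ˡ reciprocal-0ʳ

    module _ {r : ℕ} (0<r : 0 < r) (r∈F∪G : (F r ∨ G r) ≡ true) where

      reciprocal-gap : r ≤ m → m < lastUpTo F (m + m) ⊎ m < lastUpTo G (m + m)
      reciprocal-gap {m} r≤m with m <? lastUpTo F (m + m) | m <? lastUpTo G (m + m)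
      ... | yes m<a | _       = inj₁ m<a
      ... | no _    | yes m<b = inj₂ m<b
      ... | no m≮a  | no m≮b  = contradiction (trans (sym r∈F∪G) (cong₂ _∨_ Fr Gr)) λ ()
        where
        a+b≡0 : lastUpTo F (m + m) + lastUpTo G (m + m) ≡ 0
        a+b≡0 = reciprocal-lastUpTo (+-mono-≤ (≮⇒≥ m≮a) (≮⇒≥ m≮b))
        r≤2m : r ≤ m + m
        r≤2m = ≤-trans r≤m (m≤m+n m m)
        Fr : F r ≡ false
        Fr = lastUpTo-maximal (subst (_< r) (sym (m+n≡0⇒m≡0 _ a+b≡0)) 0<r) r≤2m
        Gr : G r ≡ false
        Gr = lastUpTo-maximal (subst (_< r) (sym (m+n≡0⇒n≡0 _ a+b≡0)) 0<r) r≤2m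

      jointCount-doubling : r ≤ m → jointCount F G m < jointCount F G (m + m)
      jointCount-doubling {m} r≤m with reciprocal-gap r≤m
      ... | inj₁ m<a = +-mono-<-≤ (countUpTo-< m<a (lastUpTo-≤ F 2m) (lastUpTo-∈ F 2m reciprocal-0ˡ))
                                  (countUpTo-mono (m≤m+n m m))
        where 2m = m + m
      ... | inj₂ m<b = +-mono-≤-< (countUpTo-mono (m≤m+n m m))
                                  (countUpTo-< m<b (lastUpTo-≤ G 2m) (lastUpTo-∈ G 2m reciprocal-0ʳ))
        where 2m = m + m

      jointCount-≥2+k : ∀ k → r * 2 ^ k ≤ n → 2 + k ≤ jointCount F G n
      jointCount-≥2+k {n} zero _ = jointCount-≥2 {n}
      jointCount-≥2+k {n} (suc k) r*2^[1+k]≤n = begin-strict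
        2 + k                        ≤⟨ jointCount-≥2+k k ≤-refl ⟩
        jointCount F G half          <⟨ jointCount-doubling r≤half ⟩
        jointCount F G (half + half) ≤⟨ jointCount-mono half+half≤n ⟩
        jointCount F G n             ∎
        where
        open ≤-Reasoning
        half = r * 2 ^ k
        r≤half : r ≤ half
        r≤half = m≤m*n r (2 ^ k) {{m^n≢0 2 k}}
        half+half≤n : half + half ≤ n
        half+half≤n = subst (_≤ n) (r*2^[1+k]≡r*2^k+r*2^k r k) r*2^[1+k]≤n

    jointCount-≥2+⌊log₂n/r⌋ : ∀ {r} .{{_ : NonZero r}} → (F r ∨ G r) ≡ true → r ≤ n →
                              2 + ⌊log₂ (n / r) ⌋ ≤ jointCount F G n
    jointCount-≥2+⌊log₂n/r⌋ {r = r} r∈F∪G r≤n =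
      jointCount-≥2+k (>-nonZero⁻¹ r) r∈F∪G _ (r*2^⌊log₂n/r⌋≤n r r≤n)

open JointCount using (jointCount-≥2; jointCount-≥2+⌊log₂n/r⌋)

open import Data.Nat using (ℕ; suc; _<_; _≤ᵇ_; _/_)
open import Data.Nat.Logarithm using (⌈log₂_⌉)
open import Data.Nat.Properties using (≤ᵇ⇒≤)
open import Data.Integer using (ℤ; +_; _+_; _≤_; +≤+)
open import Data.Integer.Properties using (i≤j⇒i-k≤j)
open import Data.Product using (_×_; _,_)
open import Relation.Nullary using (¬_)

theorem5p2 : (F G : Subset) → Reciprocal F G → ¬ (IsZeroSet F × IsZeroSet G) →
    (r : ℕ) → IsLeastPositiveIn r F G →
    (n : ℕ) → 0 < n →
    (+ 2) + floorLog2Ratio n r ≤ + (countUpTo F n Data.Nat.+ countUpTo G n)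
theorem5p2 F G rec _ r@(suc _) (_ , r∈F∪G , _) n@(suc k) _ with r ≤ᵇ n in r≤ᵇn
... | true  = +≤+ (jointCount-≥2+⌊log₂n/r⌋ rec r∈F∪G (≤ᵇ⇒≤ r n (subst T (sym r≤ᵇn) tt)))
... | false = i≤j⇒i-k≤j (+ ⌈log₂ ((r Data.Nat.+ k) / n) ⌉) (+≤+ (jointCount-≥2 rec {n}))
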